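{- Let $\Omega_1\subseteq\Gamma_1$ and $\Omega_2\subseteq\Gamma_2$ be subsets of abelian groups $\Gamma_1,\Gamma_2$. If there exist a $\mathrm{M}^0\mathrm{S}_{\Omega_1}(m_1,n_1;s_1,k_1;c_1)$ and a $\mathrm{M}^0\mathrm{S}_{\Omega_2}(m_2,n_2;s_2,k_2;c_2)$, then there exists a $\mathrm{M}^0\mathrm{S}_{\Omega_1\times\Omega_2}(m_1m_2,n_1n_2;s_1s_2,k_1k_2;c_1c_2)$, where $\Omega_1\times\Omega_2$ is regarded as a subset of $\Gamma_1\oplus\Gamma_2$.
   Context: A partially filled array of size $m\times n$ is an $m\times n$ array in which some cells may be empty. Given a subset $\Omega$ of an abelian group $(\Gamma,+)$, a zero-sum magic partially filled array set $\mathrm{M}^0\mathrm{S}_\Omega(m,n;s,k;c)$ is a set of $c$ partially filled $m\times n$ arrays with entries in $\Omega$ such that every element of $\Omega$ appears exactly once, in exactly one of the arrays; in every array each row has exactly $s$ filled cells and each column has exactly $k$ filled cells; and in every array the entries of each row and of each column sum to $0\in\Gamma$. -}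

module Defs where

open import Level using (Level; _⊔_; suc)
open import Algebra.Bundles using (AbelianGroup)
open import Data.Nat using (ℕ; zero) renaming (suc to sucℕ; _+_ to _+ℕ_)
open import Data.Fin using (Fin) renaming (zero to fzero; suc to fsuc)
open import Data.Maybe using (Maybe; just; nothing)
open import Data.Product using (Σ; _×_; _,_; ∃; proj₁; proj₂)
open import Relation.Binary.PropositionalEquality using (_≡_)

-- A partially filled m × n array with entries in A: an empty cell is 'nothing'.
PFArray : ∀ {a} → Set a → ℕ → ℕ → Set a
PFArray A m n = Fin m → Fin n → Maybe A

filledCount : ∀ {a} {A : Set a} (n : ℕ) → (Fin n → Maybe A) → ℕ
filledCount zero f = 0
filledCount (sucℕ n) f with f fzero
... | just _  = sucℕ (filledCount n (λ i → f (fsuc i)))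
... | nothing = filledCount n (λ i → f (fsuc i))

module _ {c ℓ} (G : AbelianGroup c ℓ) where
  open AbelianGroup G

  filledSum : (n : ℕ) → (Fin n → Maybe Carrier) → Carrier
  filledSum zero f = ε
  filledSum (sucℕ n) f with f fzero
  ... | just x  = x ∙ filledSum n (λ i → f (fsuc i))
  ... | nothing = filledSum n (λ i → f (fsuc i))

  -- A zero-sum magic partially filled array set  M⁰S_Ω(m,n;s,k;c):
  -- c partially filled m × n arrays with entries in Ω ⊆ Γ, such that
  -- every element of Ω appears exactly once (in exactly one cell of exactly one array),
  -- every row has exactly s filled cells, every column exactly k filled cells,
  -- and every row and every column sums to 0.
  record IsM0S {p} (Ω : Carrier → Set p) (m n s k cc : ℕ)
               (A : Fin cc → PFArray Carrier m n) : Set (c ⊔ ℓ ⊔ p) where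
    field
      entriesInΩ   : ∀ t i j x → A t i j ≡ just x → Ω x
      appears      : ∀ x → Ω x → Σ (Fin cc × Fin m × Fin n) λ where
                       (t , i , j) → Σ Carrier λ y → A t i j ≡ just y × y ≈ x
      appearsOnce  : ∀ x → Ω x → ∀ t i j t′ i′ j′ y y′ →
                       A t i j ≡ just y → y ≈ x →
                       A t′ i′ j′ ≡ just y′ → y′ ≈ x →
                       (t , i , j) ≡ (t′ , i′ , j′)
      rowCount     : ∀ t i → filledCount n (λ j → A t i j) ≡ s
      colCount     : ∀ t j → filledCount m (λ i → A t i j) ≡ k
      rowSum       : ∀ t i → filledSum n (λ j → A t i j) ≈ ε
      colSum       : ∀ t j → filledSum m (λ i → A t i j) ≈ ε

  M0S : ∀ {p} (Ω : Carrier → Set p) (m n s k cc : ℕ) → Set (c ⊔ ℓ ⊔ p)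
  M0S Ω m n s k cc = Σ (Fin cc → PFArray Carrier m n) (IsM0S Ω m n s k cc)

_×ₚ_ : ∀ {a b p q} {A : Set a} {B : Set b} → (A → Set p) → (B → Set q) → (A × B → Set (p ⊔ q))
(Ω₁ ×ₚ Ω₂) z = Ω₁ (proj₁ z) × Ω₂ (proj₂ z)

-- Take the Kronecker product of the two sets: the array indexed by (t₁ , t₂) has in cell
-- ((i₁ , i₂) , (j₁ , j₂)) the pair of the entries at (t₁ , i₁ , j₁) and (t₂ , i₂ , j₂), and is
-- empty unless both are filled. Each of its rows is the product u ⊛ v of a row u of the first
-- set and a row v of the second, so it has s₁ s₂ filled cells; its first coordinates add up to
-- (number of filled cells of v) · (sum of u) = 0 and its second ones to
-- (number of filled cells of u) · (sum of v) = 0. Columns are handled alike, and (x₁ , x₂)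
-- occurs exactly at the pair of the positions of x₁ and x₂.
module Submission where

open import Defs
open import Data.Nat using (ℕ; _*_)
open import Algebra.Bundles using (AbelianGroup)
open import Algebra.Construct.DirectProduct using (abelianGroup)

open import Level using (Level)
open import Algebra.Bundles using (Monoid)
import Algebra.Properties.Monoid.Sum as MonoidSum
import Algebra.Properties.CommutativeMonoid.Sum as CommutativeMonoidSum
import Algebra.Properties.Semiring.Sum as SemiringSum
open import Data.Nat using (zero; suc; _+_)
open import Data.Nat.Properties using (+-0-monoid; +-*-semiring)
open import Data.Fin using (Fin; zero; suc; combine; quotient; remainder; _↑ˡ_; _↑ʳ_)
open import Data.Fin.Properties using (remQuot-combine; combine-remQuot)
open import Data.Maybe using (Maybe; just; nothing; zip; maybe′)
open import Data.Product using (Σ; _×_; _,_; proj₁; proj₂)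
open import Function using (_∘_; id; const)
open import Relation.Binary.PropositionalEquality as ≡ using (_≡_; cong; cong₂)

module ℕ-Sum = SemiringSum +-*-semiring

private
  variable
    a b : Level
    X : Set a
    Y : Set b
    m n cc₁ m₁ n₁ cc₂ m₂ n₂ : ℕ

_⊛_ : (Fin m → Maybe X) → (Fin n → Maybe Y) → Fin (m * n) → Maybe (X × Y)
_⊛_ {m = m} {n = n} u v k = zip (u (quotient {m} n k)) (v (remainder {m} n k))

⊛-combine : (u : Fin m → Maybe X) (v : Fin n → Maybe Y) (i : Fin m) (j : Fin n) →
            (u ⊛ v) (combine i j) ≡ zip (u i) (v j)
⊛-combine u v i j = cong (λ (i′ , j′) → zip (u i′) (v j′)) (remQuot-combine i j)

module _ {c ℓ} (M : Monoid c ℓ) where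
  open Monoid M
  open MonoidSum M

  sum-↑ : ∀ m n (f : Fin (m + n) → Carrier) →
          sum f ≈ sum (f ∘ (_↑ˡ n)) ∙ sum (f ∘ (m ↑ʳ_))
  sum-↑ zero    n f = sym (identityˡ _)
  sum-↑ (suc m) n f = trans (∙-congˡ (sum-↑ m n (f ∘ suc))) (sym (assoc _ _ _))

  sum-combine : ∀ m n (f : Fin (m * n) → Carrier) →
                sum f ≈ ∑[ i < m ] ∑[ j < n ] f (combine i j)
  sum-combine zero    n f = refl
  sum-combine (suc m) n f =
    trans (sum-↑ n (m * n) f) (∙-congˡ (sum-combine m n (f ∘ (n ↑ʳ_))))

  maskedBy : Maybe X → Carrier → Carrier
  maskedBy (just _) x = x
  maskedBy nothing  _ = ε

  sum-maskedBy-zero : (w : Fin m → Maybe X) (g : Fin n → Carrier) → sum g ≈ ε →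
                   ∑[ i < m ] ∑[ j < n ] maskedBy (w i) (g j) ≈ ε
  sum-maskedBy-zero {m = m} {n = n} w g Σg≈ε = trans (sum-cong-≋ row) (sum-replicate-zero m)
    where
    row : ∀ i → ∑[ j < n ] maskedBy (w i) (g j) ≈ ε
    row i with w i
    ... | just _  = Σg≈ε
    ... | nothing = sum-replicate-zero n

  sum-⊛ : (F : Maybe (X × Y) → Carrier) (u : Fin m → Maybe X) (v : Fin n → Maybe Y) →
          sum (F ∘ (u ⊛ v)) ≈ ∑[ i < m ] ∑[ j < n ] F (zip (u i) (v j))
  sum-⊛ {m = m} {n = n} F u v = trans (sum-combine m n (F ∘ (u ⊛ v)))
    (reflexive (sum-cong-≗ λ i → sum-cong-≗ λ j → cong F (⊛-combine u v i j)))

cellCount : Maybe X → ℕ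
cellCount = maybe′ (const 1) 0

cellCount-zip : (x : Maybe X) (y : Maybe Y) → cellCount (zip x y) ≡ cellCount x * cellCount y
cellCount-zip (just _) (just _) = ≡.refl
cellCount-zip (just _) nothing  = ≡.refl
cellCount-zip nothing  _        = ≡.refl

filledCount-sum : ∀ n (f : Fin n → Maybe X) → filledCount n f ≡ ℕ-Sum.sum (cellCount ∘ f)
filledCount-sum zero    f = ≡.refl
filledCount-sum (suc n) f with f zero
... | just _  = cong suc (filledCount-sum n (f ∘ suc))
... | nothing = filledCount-sum n (f ∘ suc)

⊛-filledCount : (u : Fin m → Maybe X) (v : Fin n → Maybe Y) →
                filledCount (m * n) (u ⊛ v) ≡ filledCount m u * filledCount n v
⊛-filledCount {m = m} {n = n} u v = begin
  filledCount (m * n) (u ⊛ v)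
    ≡⟨ filledCount-sum (m * n) (u ⊛ v) ⟩
  sum (cellCount ∘ (u ⊛ v))
    ≡⟨ sum-⊛ +-0-monoid cellCount u v ⟩
  sum (λ i → sum (λ j → cellCount (zip (u i) (v j))))
    ≡⟨ sum-cong-≗ (λ i → sum-cong-≗ (λ j → cellCount-zip (u i) (v j))) ⟩
  sum (λ i → sum (λ j → cellCount (u i) * cellCount (v j)))
    ≡⟨ sum-cong-≗ (λ i → *-distribˡ-sum (cellCount (u i)) (cellCount ∘ v)) ⟨
  sum (λ i → cellCount (u i) * sum (cellCount ∘ v))
    ≡⟨ *-distribʳ-sum (sum (cellCount ∘ v)) (cellCount ∘ u) ⟨
  sum (cellCount ∘ u) * sum (cellCount ∘ v)
    ≡⟨ cong₂ _*_ (filledCount-sum m u) (filledCount-sum n v) ⟨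
  filledCount m u * filledCount n v ∎
  where
  open ≡.≡-Reasoning
  open ℕ-Sum using (sum; sum-cong-≗; *-distribˡ-sum; *-distribʳ-sum)

module _ {c ℓ} (G : AbelianGroup c ℓ) where
  open AbelianGroup G
  open MonoidSum monoid

  cellValue : Maybe Carrier → Carrier
  cellValue = maybe′ id ε

  filledSum-sum : ∀ n (f : Fin n → Maybe Carrier) → filledSum G n f ≈ sum (cellValue ∘ f)
  filledSum-sum zero    f = refl
  filledSum-sum (suc n) f with f zero
  ... | just _  = ∙-congˡ (filledSum-sum n (f ∘ suc))
  ... | nothing = trans (filledSum-sum n (f ∘ suc)) (sym (identityˡ _))

module _ {c₁ ℓ₁ c₂ ℓ₂} (Γ₁ : AbelianGroup c₁ ℓ₁) (Γ₂ : AbelianGroup c₂ ℓ₂) where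
  private
    Γ = abelianGroup Γ₁ Γ₂
    module Γ  = AbelianGroup Γ
    module Γ₁ = AbelianGroup Γ₁
    module Γ₂ = AbelianGroup Γ₂

  sum-proj₁ : (f : Fin n → Γ.Carrier) →
              proj₁ (MonoidSum.sum Γ.monoid f) ≡ MonoidSum.sum Γ₁.monoid (proj₁ ∘ f)
  sum-proj₁ {zero}  f = ≡.refl
  sum-proj₁ {suc n} f = cong (proj₁ (f zero) Γ₁.∙_) (sum-proj₁ (f ∘ suc))

  sum-proj₂ : (f : Fin n → Γ.Carrier) →
              proj₂ (MonoidSum.sum Γ.monoid f) ≡ MonoidSum.sum Γ₂.monoid (proj₂ ∘ f)
  sum-proj₂ {zero}  f = ≡.refl
  sum-proj₂ {suc n} f = cong (proj₂ (f zero) Γ₂.∙_) (sum-proj₂ (f ∘ suc))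

  cellValue-zip₁ : (x : Maybe Γ₁.Carrier) (y : Maybe Γ₂.Carrier) →
                   proj₁ (cellValue Γ (zip x y)) ≡ maskedBy Γ₁.monoid y (cellValue Γ₁ x)
  cellValue-zip₁ (just _) (just _) = ≡.refl
  cellValue-zip₁ (just _) nothing  = ≡.refl
  cellValue-zip₁ nothing  (just _) = ≡.refl
  cellValue-zip₁ nothing  nothing  = ≡.refl

  cellValue-zip₂ : (x : Maybe Γ₁.Carrier) (y : Maybe Γ₂.Carrier) →
                   proj₂ (cellValue Γ (zip x y)) ≡ maskedBy Γ₂.monoid x (cellValue Γ₂ y)
  cellValue-zip₂ (just _) (just _) = ≡.refl
  cellValue-zip₂ (just _) nothing  = ≡.refl
  cellValue-zip₂ nothing  _        = ≡.refl

  ⊛-filledSum : (u : Fin m → Maybe Γ₁.Carrier) (v : Fin n → Maybe Γ₂.Carrier) →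
                filledSum Γ₁ m u Γ₁.≈ Γ₁.ε → filledSum Γ₂ n v Γ₂.≈ Γ₂.ε →
                filledSum Γ (m * n) (u ⊛ v) Γ.≈ Γ.ε
  ⊛-filledSum {m = m} {n = n} u v Σu≈ε Σv≈ε = first , second
    where
    first : proj₁ (filledSum Γ (m * n) (u ⊛ v)) Γ₁.≈ Γ₁.ε
    first = begin
      proj₁ (filledSum Γ (m * n) (u ⊛ v))
        ≈⟨ proj₁ (filledSum-sum Γ (m * n) (u ⊛ v)) ⟩
      proj₁ (MonoidSum.sum Γ.monoid (cellValue Γ ∘ (u ⊛ v)))
        ≡⟨ sum-proj₁ (cellValue Γ ∘ (u ⊛ v)) ⟩
      sum (proj₁ ∘ cellValue Γ ∘ (u ⊛ v))
        ≈⟨ sum-⊛ Γ₁.monoid (proj₁ ∘ cellValue Γ) u v ⟩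
      ∑[ i < m ] ∑[ j < n ] proj₁ (cellValue Γ (zip (u i) (v j)))
        ≡⟨ sum-cong-≗ (λ i → sum-cong-≗ (λ j → cellValue-zip₁ (u i) (v j))) ⟩
      ∑[ i < m ] ∑[ j < n ] maskedBy Γ₁.monoid (v j) (cellValue Γ₁ (u i))
        ≈⟨ ∑-comm (λ i j → maskedBy Γ₁.monoid (v j) (cellValue Γ₁ (u i))) ⟩
      ∑[ j < n ] ∑[ i < m ] maskedBy Γ₁.monoid (v j) (cellValue Γ₁ (u i))
        ≈⟨ sum-maskedBy-zero Γ₁.monoid v (cellValue Γ₁ ∘ u)
             (Γ₁.trans (Γ₁.sym (filledSum-sum Γ₁ m u)) Σu≈ε) ⟩
      Γ₁.ε ∎
      where
      open CommutativeMonoidSum Γ₁.commutativeMonoid using (sum; sum-syntax; sum-cong-≗; ∑-comm)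
      open import Relation.Binary.Reasoning.Setoid Γ₁.setoid

    second : proj₂ (filledSum Γ (m * n) (u ⊛ v)) Γ₂.≈ Γ₂.ε
    second = begin
      proj₂ (filledSum Γ (m * n) (u ⊛ v))
        ≈⟨ proj₂ (filledSum-sum Γ (m * n) (u ⊛ v)) ⟩
      proj₂ (MonoidSum.sum Γ.monoid (cellValue Γ ∘ (u ⊛ v)))
        ≡⟨ sum-proj₂ (cellValue Γ ∘ (u ⊛ v)) ⟩
      sum (proj₂ ∘ cellValue Γ ∘ (u ⊛ v))
        ≈⟨ sum-⊛ Γ₂.monoid (proj₂ ∘ cellValue Γ) u v ⟩
      ∑[ i < m ] ∑[ j < n ] proj₂ (cellValue Γ (zip (u i) (v j)))
        ≡⟨ sum-cong-≗ (λ i → sum-cong-≗ (λ j → cellValue-zip₂ (u i) (v j))) ⟩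
      ∑[ i < m ] ∑[ j < n ] maskedBy Γ₂.monoid (u i) (cellValue Γ₂ (v j))
        ≈⟨ sum-maskedBy-zero Γ₂.monoid u (cellValue Γ₂ ∘ v)
             (Γ₂.trans (Γ₂.sym (filledSum-sum Γ₂ n v)) Σv≈ε) ⟩
      Γ₂.ε ∎
      where
      open MonoidSum Γ₂.monoid using (sum; sum-syntax; sum-cong-≗)
      open import Relation.Binary.Reasoning.Setoid Γ₂.setoid

_⊠_ : PFArray X m₁ n₁ → PFArray Y m₂ n₂ → PFArray (X × Y) (m₁ * m₂) (n₁ * n₂)
_⊠_ {m₁ = m₁} {m₂ = m₂} P Q i = P (quotient {m₁} m₂ i) ⊛ Q (remainder {m₁} m₂ i)

kronecker : (Fin cc₁ → PFArray X m₁ n₁) → (Fin cc₂ → PFArray Y m₂ n₂) →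
            Fin (cc₁ * cc₂) → PFArray (X × Y) (m₁ * m₂) (n₁ * n₂)
kronecker {cc₁ = cc₁} {cc₂ = cc₂} A B t = A (quotient {cc₁} cc₂ t) ⊠ B (remainder {cc₁} cc₂ t)

kronecker-combine : (A : Fin cc₁ → PFArray X m₁ n₁) (B : Fin cc₂ → PFArray Y m₂ n₂)
                    (t₁ : Fin cc₁) (i₁ : Fin m₁) (j₁ : Fin n₁)
                    (t₂ : Fin cc₂) (i₂ : Fin m₂) (j₂ : Fin n₂) →
                    kronecker A B (combine t₁ t₂) (combine i₁ i₂) (combine j₁ j₂) ≡
                    zip (A t₁ i₁ j₁) (B t₂ i₂ j₂)
kronecker-combine A B t₁ i₁ j₁ t₂ i₂ j₂ =
  cong (λ ((t₁′ , t₂′) , (i₁′ , i₂′) , (j₁′ , j₂′)) → zip (A t₁′ i₁′ j₁′) (B t₂′ i₂′ j₂′))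
       (cong₂ _,_ (remQuot-combine t₁ t₂) (cong₂ _,_ (remQuot-combine i₁ i₂) (remQuot-combine j₁ j₂)))

zip-just : {x : Maybe X} {y : Maybe Y} {z : X × Y} →
           zip x y ≡ just z → x ≡ just (proj₁ z) × y ≡ just (proj₂ z)
zip-just {x = just _} {y = just _}  ≡.refl = ≡.refl , ≡.refl
zip-just {x = just _} {y = nothing} ()
zip-just {x = nothing}              ()

remQuot-injective : ∀ {m} n {x y : Fin (m * n)} →
                    quotient {m} n x ≡ quotient {m} n y →
                    remainder {m} n x ≡ remainder {m} n y → x ≡ y
remQuot-injective {m} n {x} {y} q r = begin
  x                                              ≡⟨ combine-remQuot {m} n x ⟨
  combine (quotient {m} n x) (remainder {m} n x) ≡⟨ cong₂ combine q r ⟩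
  combine (quotient {m} n y) (remainder {m} n y) ≡⟨ combine-remQuot {m} n y ⟩
  y                                              ∎
  where open ≡.≡-Reasoning

remQuot³-injective : {t t′ : Fin (cc₁ * cc₂)} {i i′ : Fin (m₁ * m₂)} {j j′ : Fin (n₁ * n₂)} →
  (quotient {cc₁} cc₂ t , quotient {m₁} m₂ i , quotient {n₁} n₂ j) ≡
  (quotient {cc₁} cc₂ t′ , quotient {m₁} m₂ i′ , quotient {n₁} n₂ j′) →
  (remainder {cc₁} cc₂ t , remainder {m₁} m₂ i , remainder {n₁} n₂ j) ≡
  (remainder {cc₁} cc₂ t′ , remainder {m₁} m₂ i′ , remainder {n₁} n₂ j′) →
  (t , i , j) ≡ (t′ , i′ , j′)
remQuot³-injective {cc₁ = cc₁} {cc₂ = cc₂} {m₁ = m₁} {m₂ = m₂} {n₁ = n₁} {n₂ = n₂} q r =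
  cong₂ _,_ (remQuot-injective {cc₁} cc₂ (cong proj₁ q) (cong proj₁ r))
    (cong₂ _,_ (remQuot-injective {m₁} m₂ (cong (proj₁ ∘ proj₂) q) (cong (proj₁ ∘ proj₂) r))
               (remQuot-injective {n₁} n₂ (cong (proj₂ ∘ proj₂) q) (cong (proj₂ ∘ proj₂) r)))

module _ {c₁ ℓ₁ c₂ ℓ₂ p₁ p₂} {Γ₁ : AbelianGroup c₁ ℓ₁} {Γ₂ : AbelianGroup c₂ ℓ₂}
         {Ω₁ : AbelianGroup.Carrier Γ₁ → Set p₁} {Ω₂ : AbelianGroup.Carrier Γ₂ → Set p₂}
         {m₁ n₁ s₁ k₁ cc₁ m₂ n₂ s₂ k₂ cc₂ : ℕ}
         {A : Fin cc₁ → PFArray (AbelianGroup.Carrier Γ₁) m₁ n₁}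
         {B : Fin cc₂ → PFArray (AbelianGroup.Carrier Γ₂) m₂ n₂} where

  kronecker-isM0S : IsM0S Γ₁ Ω₁ m₁ n₁ s₁ k₁ cc₁ A → IsM0S Γ₂ Ω₂ m₂ n₂ s₂ k₂ cc₂ B →
                    IsM0S (abelianGroup Γ₁ Γ₂) (Ω₁ ×ₚ Ω₂) (m₁ * m₂) (n₁ * n₂) (s₁ * s₂) (k₁ * k₂)
                          (cc₁ * cc₂) (kronecker A B)
  kronecker-isM0S isA isB = record
    { entriesInΩ  = λ t i j x e → let (e₁ , e₂) = zip-just e in
                      A.entriesInΩ _ _ _ _ e₁ , B.entriesInΩ _ _ _ _ e₂
    ; appears     = appears
    ; appearsOnce = λ x (o₁ , o₂) t i j t′ i′ j′ y y′ e y≈x e′ y′≈x →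
        let (e₁ , e₂) = zip-just e; (e₁′ , e₂′) = zip-just e′ in
        remQuot³-injective
          (A.appearsOnce _ o₁ _ _ _ _ _ _ _ _ e₁ (proj₁ y≈x) e₁′ (proj₁ y′≈x))
          (B.appearsOnce _ o₂ _ _ _ _ _ _ _ _ e₂ (proj₂ y≈x) e₂′ (proj₂ y′≈x))
    ; rowCount    = λ t i → ≡.trans (⊛-filledCount (A _ _) (B _ _))
                              (cong₂ _*_ (A.rowCount _ _) (B.rowCount _ _))
    ; colCount    = λ t j → ≡.trans (⊛-filledCount (λ i → A _ i _) (λ i → B _ i _))
                              (cong₂ _*_ (A.colCount _ _) (B.colCount _ _))
    ; rowSum      = λ t i → ⊛-filledSum Γ₁ Γ₂ (A _ _) (B _ _) (A.rowSum _ _) (B.rowSum _ _)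
    ; colSum      = λ t j → ⊛-filledSum Γ₁ Γ₂ (λ i → A _ i _) (λ i → B _ i _)
                              (A.colSum _ _) (B.colSum _ _)
    }
    where
    module A = IsM0S isA
    module B = IsM0S isB

    appears : ∀ x → (Ω₁ ×ₚ Ω₂) x →
              Σ (Fin (cc₁ * cc₂) × Fin (m₁ * m₂) × Fin (n₁ * n₂)) λ (t , i , j) →
                Σ _ λ y → kronecker A B t i j ≡ just y × AbelianGroup._≈_ (abelianGroup Γ₁ Γ₂) y x
    appears (x₁ , x₂) (o₁ , o₂) =
      let ((t₁ , i₁ , j₁) , y₁ , e₁ , y₁≈x₁) = A.appears x₁ o₁
          ((t₂ , i₂ , j₂) , y₂ , e₂ , y₂≈x₂) = B.appears x₂ o₂
      in (combine t₁ t₂ , combine i₁ i₂ , combine j₁ j₂) , (y₁ , y₂) ,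
         ≡.trans (kronecker-combine A B t₁ i₁ j₁ t₂ i₂ j₂) (cong₂ zip e₁ e₂) , (y₁≈x₁ , y₂≈x₂)

lemma2p3 : ∀ {c₁ ℓ₁ c₂ ℓ₂ p₁ p₂}
    (Γ₁ : AbelianGroup c₁ ℓ₁) (Γ₂ : AbelianGroup c₂ ℓ₂)
    (Ω₁ : AbelianGroup.Carrier Γ₁ → Set p₁) (Ω₂ : AbelianGroup.Carrier Γ₂ → Set p₂)
    (m₁ n₁ s₁ k₁ cc₁ m₂ n₂ s₂ k₂ cc₂ : ℕ) →
    M0S Γ₁ Ω₁ m₁ n₁ s₁ k₁ cc₁ →
    M0S Γ₂ Ω₂ m₂ n₂ s₂ k₂ cc₂ →
    M0S (abelianGroup Γ₁ Γ₂) (Ω₁ ×ₚ Ω₂) (m₁ * m₂) (n₁ * n₂) (s₁ * s₂) (k₁ * k₂) (cc₁ * cc₂)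
lemma2p3 _ _ _ _ _ _ _ _ _ _ _ _ _ _ (A , isA) (B , isB) = kronecker A B , kronecker-isM0S isA isB
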